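{- Let $H$ be a reflexive triangle-free graph, $G$ a reflexive graph, $\phi,\psi:G\to H$ homomorphisms, and $(W_v)_{v\in V(G)}$ a system of walks for $\phi$ and $\psi$ that is realizable. If a vertex $c\in V(G)$ is fixed under $\phi$, then $W_c$ is a constant walk.
   Context: A graph is reflexive if every vertex has a loop. $\operatorname{Hom}(G,H)$ has the homomorphisms $G\to H$ as vertices, with $\phi\sim\psi$ if $\phi(u)\psi(v)\in E(H)$ for every edge $uv\in E(G)$; a reconfiguration from $\phi$ to $\psi$ is a walk $\phi=\phi_1,\dots,\phi_d=\psi$ in $\operatorname{Hom}(G,H)$, and the trace of $v$ under it is $(\phi_1(v),\dots,\phi_d(v))$. Walks in a reflexive graph are sequences of vertices with consecutive vertices adjacent (possibly equal); a walk is constant if all its vertices are equal. A system of walks for $\phi,\psi$ is a family $(W_v)$ with $W_v$ a $(\phi(v),\psi(v))$-walk in $H$; it is realizable if, after possibly inserting repetitions of vertices into the walks, it becomes the system of traces of some reconfiguration from $\phi$ to $\psi$. $\Pi(H;a,b)$ is the graph on $(a,b)$-walks of $H$ where $X=(x_0,\dots,x_\ell)$ and $Y$ are adjacent if (P1) $Y=(x_0,\dots,x_i,x_i,\dots,x_\ell)$, or (P2) $Y=(x_0,\dots,x_{i-1},x_i',x_{i+1},\dots,x_\ell)$ for some $0<i<\ell$ with $x_i'\sim x_i$ and $Y$ a walk (adjacency symmetric); a closed walk at $r$ is contractible if its component in $\Pi(H;r,r)$ contains $(r)$. $\Pi(H)$ is obtained from the disjoint union over $r$ of $\Pi(H;r,r)$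 by also joining $y$ and $x=(x_0,x_1,\dots,x_{\ell-1},x_0)$ whenever $x_1=x_{\ell-1}$ and $y=(x_1,\dots,x_{\ell-1})$; a closed walk $D$ is free-reduced if it is a shortest closed walk in its component of $\Pi(H)$. A closed walk $C$ of $G$ is tight under $\phi$ if $\phi(C)$ is non-contractible and free-reduced; a vertex is fixed under $\phi$ if it lies on some closed walk that is tight under $\phi$. -}

module Defs where

open import Level using (0ℓ)
open import Data.Nat using (ℕ; _≤_)
open import Data.Fin using (Fin)
open import Data.List using (List; []; _∷_; [_]; _++_; map; length)
open import Data.List.Relation.Unary.All using (All)
open import Data.List.Membership.Propositional using (_∈_)
open import Data.Product using (Σ; ∃; _×_; _,_)
open import Data.Sum using (_⊎_)
open import Relation.Nullary using (¬_)
open import Relation.Binary.PropositionalEquality using (_≡_; _≢_)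
open import Relation.Binary.Construct.Closure.ReflexiveTransitive using (Star)

record Graph : Set₁ where
  field
    n   : ℕ
    _~_ : Fin n → Fin n → Set
    ~-sym : ∀ {u v} → u ~ v → v ~ u

open Graph public

V : Graph → Set
V G = Fin (n G)

IsReflexive : Graph → Set
IsReflexive G = ∀ (v : V G) → _~_ G v v

TriangleFree : Graph → Set
TriangleFree G = ∀ (x y z : V G) → x ≢ y → y ≢ z → x ≢ z →
  ¬ (_~_ G x y × _~_ G y z × _~_ G x z)

data WalkFT (G : Graph) : V G → V G → List (V G) → Set where
  single : ∀ x → WalkFT G x x [ x ]
  cons   : ∀ {x y b xs} → _~_ G x y → WalkFT G y b (y ∷ xs) →
           WalkFT G x b (x ∷ y ∷ xs)

Constant : {A : Set} → List A → Set
Constant {A} w = Σ A λ x → All (_≡ x) w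

IsHom : (G H : Graph) → (V G → V H) → Set
IsHom G H f = ∀ {u v} → _~_ G u v → _~_ H (f u) (f v)

HomAdj : (G H : Graph) → (V G → V H) → (V G → V H) → Set
HomAdj G H f g = ∀ {u v} → _~_ G u v → _~_ H (f u) (g v)

-- Reconf G H φ ψ fs : fs = (φ = φ₁, …, φ_d) is a walk in Hom(G,H) from φ
-- to ψ (the last map agrees with ψ pointwise).
data Reconf (G H : Graph) : (V G → V H) → (V G → V H) → List (V G → V H) → Set where
  end  : ∀ {f g} → IsHom G H f → (∀ v → f v ≡ g v) → Reconf G H f g [ f ]
  step : ∀ {f g ψ rest} → IsHom G H f → HomAdj G H f g →
         Reconf G H g ψ (g ∷ rest) → Reconf G H f ψ (f ∷ g ∷ rest)

trace : {G H : Graph} → V G → List (V G → V H) → List (V H)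
trace v fs = map (λ f → f v) fs

-- Stutter xs ys : ys is obtained from xs by inserting repetitions of
-- vertices (each entry x of xs is replaced by x repeated k ≥ 1 times).
data Stutter {A : Set} : List A → List A → Set where
  []   : Stutter [] []
  keep : ∀ {x xs ys} → Stutter xs ys → Stutter (x ∷ xs) (x ∷ ys)
  dup  : ∀ {x xs ys} → Stutter (x ∷ xs) ys → Stutter (x ∷ xs) (x ∷ ys)

SystemOfWalks : (G H : Graph) → (φ ψ : V G → V H) → (V G → List (V H)) → Set
SystemOfWalks G H φ ψ W = ∀ v → WalkFT H (φ v) (ψ v) (W v)

Realizable : (G H : Graph) → (φ ψ : V G → V H) → (V G → List (V H)) → Set
Realizable G H φ ψ W =
  Σ (List (V G → V H)) λ fs → Reconf G H φ ψ fs × (∀ v → Stutter (W v) (trace {G} {H} v fs))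

data PStep (H : Graph) : List (V H) → List (V H) → Set where
  P1 : ∀ pre x post → PStep H (pre ++ x ∷ post) (pre ++ x ∷ x ∷ post)
  P2 : ∀ pre x x′ post → pre ≢ [] → post ≢ [] → _~_ H x′ x →
       PStep H (pre ++ x ∷ post) (pre ++ x′ ∷ post)

ΠAdj : (H : Graph) → V H → V H → List (V H) → List (V H) → Set
ΠAdj H a b X Y = WalkFT H a b X × WalkFT H a b Y × (PStep H X Y ⊎ PStep H Y X)

Contractible : (H : Graph) → V H → List (V H) → Set
Contractible H r D = Star (ΠAdj H r r) D [ r ]

-- the extra edges of Π(H): x = (x₀, y, x₀) with y = (x₁,…,x_{ℓ-1}), x₁ = x_{ℓ-1}
Conj : (H : Graph) → List (V H) → List (V H) → Set
Conj H y x = Σ (V H) λ x₀ → Σ (V H) λ r →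
  WalkFT H x₀ x₀ x × WalkFT H r r y × x ≡ x₀ ∷ (y ++ [ x₀ ])

ΠHAdj : (H : Graph) → List (V H) → List (V H) → Set
ΠHAdj H X Y = (Σ (V H) λ r → ΠAdj H r r X Y) ⊎ Conj H X Y ⊎ Conj H Y X

FreeReduced : (H : Graph) → List (V H) → Set
FreeReduced H D = (Σ (V H) λ r → WalkFT H r r D) ×
  (∀ D′ → Star (ΠHAdj H) D D′ → length D ≤ length D′)

Tight : (G H : Graph) → (V G → V H) → List (V G) → Set
Tight G H φ C = Σ (V G) λ c₀ → WalkFT G c₀ c₀ C ×
  ¬ Contractible H (φ c₀) (map φ C) × FreeReduced H (map φ C)

Fixed : (G H : Graph) → (V G → V H) → V G → Set
Fixed G H φ c = Σ (List (V G)) λ C → Tight G H φ C × c ∈ C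

-- Every vertex v of a closed walk C that is tight under φ is the middle of a corner u v w of C
-- whose images are pairwise distinct: a shortest walk in its component of Π(H) has no
-- stutter (P1), no backtrack (P2 followed by P1) and, at its base point, no cyclic backtrack
-- (an extra edge of Π(H)).  A neighbour φ′ of φ in Hom(G,H) maps v to a common neighbour of
-- φ u, φ v, φ w, and in a triangle-free graph that can only be φ v.  So φ′ agrees with φ on C,
-- C stays tight, and along the reconfiguration the trace of c is constant; W c, from which the
-- trace arises by inserting repetitions, is then constant as well.

module Submission where

open import Defs
open import Data.Empty using (⊥-elim)
open import Data.Fin using (_≟_)
open import Data.List using (List; []; _∷_; [_]; _++_; _∷ʳ_; map; length; initLast; _∷ʳ′_)
open import Data.List.Properties using (map-++; map-cong-local; length-++; length-++-sucʳ; length-++-≤ˡ; ∷ʳ-++; ++-conicalʳ)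
open import Data.List.Membership.Propositional using (_∈_)
open import Data.List.Membership.Propositional.Properties using (∈-∃++)
open import Data.List.Relation.Unary.All as All using (All; []; _∷_)
open import Data.List.Relation.Unary.All.Properties using (map⁺)
open import Data.List.Relation.Unary.Any using (here)
open import Data.Nat using (_≤_; _<_; s≤s)
open import Data.Nat.Properties using (<⇒≱; ≤-reflexive)
open import Data.Product using (∃₂; _×_; _,_)
open import Data.Sum using (inj₁; inj₂)
open import Relation.Nullary using (¬_; yes; no)
open import Relation.Binary.PropositionalEquality using (_≡_; _≢_; refl; sym; trans; cong; subst; subst₂; ≢-sym; module ≡-Reasoning)
open import Relation.Binary.Construct.Closure.ReflexiveTransitive using (Star; ε; _◅_)

All-stutter⁻ : {A : Set} {P : A → Set} {xs ys : List A} → Stutter xs ys → All P ys → All P xs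
All-stutter⁻ []       []         = []
All-stutter⁻ (keep s) (px ∷ pys) = px ∷ All-stutter⁻ s pys
All-stutter⁻ (dup s)  (_ ∷ pys)  = All-stutter⁻ s pys

module _ {K : Graph} where

  walk-head : ∀ {a b x xs} → WalkFT K a b (x ∷ xs) → x ≡ a
  walk-head (single _) = refl
  walk-head (cons _ _) = refl

  walk-start∈ : ∀ {a b xs} → WalkFT K a b xs → a ∈ xs
  walk-start∈ (single _) = here refl
  walk-start∈ (cons _ _) = here refl

  walk-last : ∀ xs {a b x} → WalkFT K a b (xs ++ [ x ]) → x ≡ b
  walk-last []           (single _) = refl
  walk-last (_ ∷ [])     (cons _ w) = walk-last [] w
  walk-last (_ ∷ y ∷ xs) (cons _ w) = walk-last (y ∷ xs) w

  walk-edge : ∀ pre {a b u v post} → WalkFT K a b (pre ++ u ∷ v ∷ post) → _~_ K u v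
  walk-edge []            (cons e _) = e
  walk-edge (_ ∷ [])      (cons _ w) = walk-edge [] w
  walk-edge (_ ∷ y ∷ pre) (cons _ w) = walk-edge (y ∷ pre) w

  walk-cons : ∀ {x y b ys} → _~_ K x y → WalkFT K y b ys → WalkFT K x b (x ∷ ys)
  walk-cons e w@(single _) = cons e w
  walk-cons e w@(cons _ _) = cons e w

  walk-unsnoc : ∀ {a b x y xs} → WalkFT K a b (x ∷ y ∷ xs) →
    ∃₂ λ ys p → x ∷ y ∷ xs ≡ ys ++ p ∷ [ b ] × WalkFT K a p (ys ++ [ p ])
  walk-unsnoc (cons _ (single _)) = [] , _ , refl , single _
  walk-unsnoc (cons e w@(cons _ _)) with walk-unsnoc w
  ... | ys , p , eq , w′ = _ ∷ ys , p , cong (_ ∷_) eq , walk-cons e w′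

  walk-destutter : ∀ pre {a b x post} →
    WalkFT K a b (pre ++ x ∷ x ∷ post) → WalkFT K a b (pre ++ x ∷ post)
  walk-destutter []            (cons _ w) = w
  walk-destutter (_ ∷ [])      (cons e w) = cons e (walk-destutter [] w)
  walk-destutter (_ ∷ y ∷ pre) (cons e w) = cons e (walk-destutter (y ∷ pre) w)

  walk-flatten : IsReflexive K → ∀ pre {a b x y post} →
    WalkFT K a b (pre ++ x ∷ y ∷ x ∷ post) → WalkFT K a b (pre ++ x ∷ x ∷ x ∷ post)
  walk-flatten reflK []            (cons _ (cons _ w)) = cons (reflK _) (cons (reflK _) w)
  walk-flatten reflK (_ ∷ [])      (cons e w)          = cons e (walk-flatten reflK [] w)
  walk-flatten reflK (_ ∷ y ∷ pre) (cons e w)          = cons e (walk-flatten reflK (y ∷ pre) w)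

walk-map : ∀ {G H f a b xs} → IsHom G H f → WalkFT G a b xs → WalkFT H (f a) (f b) (map f xs)
walk-map _  (single _) = single _
walk-map hf (cons e w) = cons (hf e) (walk-map hf w)

module _ {H : Graph} where

  freeReduced-shortest : ∀ {D D′} → FreeReduced H D → Star (ΠHAdj H) D D′ → ¬ length D′ < length D
  freeReduced-shortest (_ , shortest) D⇝D′ D′<D = <⇒≱ D′<D (shortest _ D⇝D′)

  freeReduced-along : ∀ {r D D₁} → FreeReduced H D → ΠAdj H r r D D₁ → length D₁ ≡ length D →
    FreeReduced H D₁
  freeReduced-along (_ , shortest) adj@(_ , w₁ , _) eq =
    (_ , w₁) , λ D′ D₁⇝D′ → subst (_≤ length D′) (sym eq) (shortest D′ (inj₁ (_ , adj) ◅ D₁⇝D′))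

  freeReduced-no-stutter : ∀ {D} → FreeReduced H D → ∀ pre {a b post} →
    D ≡ pre ++ a ∷ b ∷ post → a ≢ b
  freeReduced-no-stutter fr@((_ , w) , _) pre {a} {post = post} refl refl =
    freeReduced-shortest fr (inj₁ (_ , w , walk-destutter pre w , inj₂ (P1 pre a post)) ◅ ε)
      (≤-reflexive (sym (length-++-sucʳ pre a (a ∷ post))))

  freeReduced-no-backtrack : IsReflexive H → ∀ {D} → FreeReduced H D → ∀ pre {a b c post} →
    D ≡ pre ++ a ∷ b ∷ c ∷ post → a ≢ c
  freeReduced-no-backtrack reflH fr@((_ , w) , _) pre {a} {b} {post = post} refl refl =
    freeReduced-no-stutter (freeReduced-along fr (w , flattened , inj₁ b↦a) sameLength) pre refl refl
    where
    flattened : WalkFT H _ _ (pre ++ a ∷ a ∷ a ∷ post)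
    flattened = walk-flatten reflH pre w
    pre∷ʳa≢[] : pre ∷ʳ a ≢ []
    pre∷ʳa≢[] eq with () ← ++-conicalʳ pre [ a ] eq
    b↦a : PStep H (pre ++ a ∷ b ∷ a ∷ post) (pre ++ a ∷ a ∷ a ∷ post)
    b↦a = subst₂ (PStep H) (∷ʳ-++ pre a _) (∷ʳ-++ pre a _)
            (P2 (pre ∷ʳ a) b a (a ∷ post) pre∷ʳa≢[] (λ ()) (walk-edge pre w))
    sameLength : length (pre ++ a ∷ a ∷ a ∷ post) ≡ length (pre ++ a ∷ b ∷ a ∷ post)
    sameLength = trans (length-++ pre) (sym (length-++ pre))

  -- If a ≡ b then Y is closed, and an extra edge of Π(H) joins x₀ Y x₀ to the shorter Y.
  freeReduced-no-cyclic-backtrack : ∀ {D x₀ Y a b} → FreeReduced H D → D ≡ x₀ ∷ Y ++ [ x₀ ] →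
    WalkFT H a b Y → a ≢ b
  freeReduced-no-cyclic-backtrack {Y = Y} fr@((_ , w) , _) refl wY refl =
    freeReduced-shortest fr (inj₂ (inj₂ (_ , _ , closed , wY , refl)) ◅ ε) (s≤s (length-++-≤ˡ Y))
    where closed = subst (λ s → WalkFT H s s _) (sym (walk-head w)) w

triangleFree-common-neighbour : ∀ {H} → TriangleFree H → ∀ {a b c x} →
  _~_ H a b → _~_ H b c → a ≢ b → b ≢ c → a ≢ c →
  _~_ H a x → _~_ H b x → _~_ H c x → x ≡ b
triangleFree-common-neighbour tf {a} {b} {c} {x} ab bc a≢b b≢c a≢c ax bx cx with x ≟ b | x ≟ a
... | yes x≡b | _        = x≡b
... | no x≢b  | no x≢a   = ⊥-elim (tf a b x a≢b (≢-sym x≢b) (≢-sym x≢a) (ab , bx , ax))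
... | no x≢b  | yes refl = ⊥-elim (tf b c x b≢c (≢-sym a≢c) (≢-sym x≢b) (bc , cx , bx))

record Corner (G H : Graph) (φ : V G → V H) (v : V G) : Set where
  field
    {u w} : V G
    u~v   : _~_ G u v
    v~w   : _~_ G v w
    φu≢φv : φ u ≢ φ v
    φv≢φw : φ v ≢ φ w
    φu≢φw : φ u ≢ φ w

corner-fixed : ∀ {G H φ φ′ v} → IsReflexive G → TriangleFree H → IsHom G H φ → HomAdj G H φ φ′ →
  Corner G H φ v → φ′ v ≡ φ v
corner-fixed {G} {H} reflG tf hφ φ~φ′ c = triangleFree-common-neighbour {H} tf (hφ u~v) (hφ v~w)
  φu≢φv φv≢φw φu≢φw (φ~φ′ u~v) (φ~φ′ (reflG _)) (φ~φ′ (~-sym G v~w))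
  where open Corner c

module _ {G H : Graph} (reflH : IsReflexive H) {φ : V G → V H} (hφ : IsHom G H φ) where

  corner-inside : ∀ {C a b} → FreeReduced H (map φ C) → WalkFT G a b C →
    ∀ pre {u v w post} → C ≡ pre ++ u ∷ v ∷ w ∷ post → Corner G H φ v
  corner-inside fr wC pre {u} refl = record
    { u~v   = walk-edge pre wC
    ; v~w   = walk-edge (pre ∷ʳ u) (subst (WalkFT G _ _) (sym (∷ʳ-++ pre u _)) wC)
    ; φu≢φv = freeReduced-no-stutter fr (map φ pre) images
    ; φv≢φw = freeReduced-no-stutter fr (map φ pre ∷ʳ φ u) (trans images (sym (∷ʳ-++ _ (φ u) _)))
    ; φu≢φw = freeReduced-no-backtrack reflH fr (map φ pre) images
    }
    where images = map-++ φ pre _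

  corner-at-base : ∀ {c₀ C} → WalkFT G c₀ c₀ C → ¬ Contractible H (φ c₀) (map φ C) →
    FreeReduced H (map φ C) → Corner G H φ c₀
  corner-at-base (single _)          nc _  = ⊥-elim (nc ε)
  corner-at-base (cons _ (single _)) _  fr = ⊥-elim (freeReduced-no-stutter fr [] refl refl)
  corner-at-base {c₀} (cons c₀~c₁ w@(cons _ _)) _ fr with walk-unsnoc w
  ... | ys , p , eq , wY = record
    { u~v   = walk-edge ys (subst (WalkFT G _ _) eq w)
    ; v~w   = c₀~c₁
    ; φu≢φv = freeReduced-no-stutter fr (φ c₀ ∷ map φ ys) imagesAtEnd
    ; φv≢φw = freeReduced-no-stutter fr [] refl
    ; φu≢φw = ≢-sym (freeReduced-no-cyclic-backtrack fr imagesAround (walk-map hφ wY))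
    }
    where
    open ≡-Reasoning
    imagesAtEnd : φ c₀ ∷ map φ (_ ∷ _ ∷ _) ≡ φ c₀ ∷ map φ ys ++ φ p ∷ [ φ c₀ ]
    imagesAtEnd = cong (φ c₀ ∷_) (trans (cong (map φ) eq) (map-++ φ ys _))
    imagesAround : φ c₀ ∷ map φ (_ ∷ _ ∷ _) ≡ φ c₀ ∷ map φ (ys ++ [ p ]) ++ [ φ c₀ ]
    imagesAround = cong (φ c₀ ∷_) (begin
      map φ (_ ∷ _ ∷ _)             ≡⟨ cong (map φ) (trans eq (sym (∷ʳ-++ ys p _))) ⟩
      map φ ((ys ++ [ p ]) ++ [ c₀ ]) ≡⟨ map-++ φ (ys ++ [ p ]) _ ⟩
      map φ (ys ++ [ p ]) ++ [ φ c₀ ] ∎)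

  tight-corner : ∀ {C c} → Tight G H φ C → c ∈ C → Corner G H φ c
  tight-corner (c₀ , wC , nc , fr) c∈C with ∈-∃++ c∈C
  ... | pre , [] , eq = subst (Corner G H φ) (sym (walk-last pre (subst (WalkFT G c₀ c₀) eq wC)))
                          (corner-at-base wC nc fr)
  ... | pre , w ∷ post , eq with initLast pre
  ...   | []         = subst (Corner G H φ) (sym (walk-head (subst (WalkFT G c₀ c₀) eq wC)))
                         (corner-at-base wC nc fr)
  ...   | pre′ ∷ʳ′ u = corner-inside fr wC pre′ (trans eq (∷ʳ-++ pre′ u _))

tight-resp : ∀ {G H φ φ′ C} → All (λ c → φ′ c ≡ φ c) C → Tight G H φ C → Tight G H φ′ C
tight-resp {H = H} agree (c₀ , wC , nc , fr) =
  c₀ , wC , (λ contr → nc (subst₂ (Contractible H) (All.lookup agree (walk-start∈ wC)) images contr))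
     , subst (FreeReduced H) (sym images) fr
  where images = map-cong-local agree

module _ {G H : Graph} (reflG : IsReflexive G) (reflH : IsReflexive H) (tf : TriangleFree H) where

  reconf-fixes-tight : ∀ {φ ψ fs C c} → Reconf G H φ ψ fs → Tight G H φ C → c ∈ C →
    All (λ f → f c ≡ φ c) fs
  reconf-fixes-tight (end _ _) _ _ = refl ∷ []
  reconf-fixes-tight (step hφ φ~φ′ rest) tight c∈C =
    refl ∷ All.map (λ e → trans e (All.lookup agree c∈C))
                   (reconf-fixes-tight rest (tight-resp agree tight) c∈C)
    where agree = All.tabulate λ c∈C → corner-fixed reflG tf hφ φ~φ′ (tight-corner reflH hφ tight c∈C)

fact6p3 : (G H : Graph) → IsReflexive H → TriangleFree H → IsReflexive G →
          (φ ψ : V G → V H) → IsHom G H φ → IsHom G H ψ →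
          (W : V G → List (V H)) → SystemOfWalks G H φ ψ W →
          Realizable G H φ ψ W →
          (c : V G) → Fixed G H φ c → Constant (W c)
fact6p3 G H reflH tf reflG φ ψ _ _ W _ (fs , φ⇝ψ , traces) c (C , tight , c∈C) =
  φ c , All-stutter⁻ (traces c) (map⁺ (reconf-fixes-tight reflG reflH tf φ⇝ψ tight c∈C))
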